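{- Let $D$ be a loose multipartite tournament in which no vertex has outdegree one and every partite set has at most three vertices. Then $C_{1,2}(D)$ is chordal.
   Context: All graphs and digraphs are finite and simple. For a digraph $D$, $d_D(x,y)$ is the length of a shortest directed path from $x$ to $y$. The $(1,2)$-step competition graph $C_{1,2}(D)$ is the graph on $V(D)$ in which distinct $u,v$ are adjacent iff there is a vertex $w\notin\{u,v\}$ with either $d_{D-v}(u,w)\le 1$ and $d_{D-u}(v,w)\le 2$, or $d_{D-u}(v,w)\le 1$ and $d_{D-v}(u,w)\le 2$. A multipartite tournament is an orientation of a complete $k$-partite graph for some $k\ge3$ (with nonempty partite sets). A set of vertices is $\{1,2\}$-competing if it is a clique in $C_{1,2}(D)$. A multipartite tournament is loose if some partite set is not $\{1,2\}$-competing. A graph is chordal if it has no induced cycle of length at least four. -}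

module Defs where

open import Data.Nat using (ℕ; zero; suc; _≤_)
open import Data.Nat.ListAction using (sum)
open import Data.Fin using (Fin; toℕ; _≟_)
open import Data.Bool using (Bool; true; false; if_then_else_; T)
open import Data.List using (List; map; allFin)
open import Data.Product using (Σ; _×_; ∃; ∃-syntax)
open import Data.Sum using (_⊎_)
open import Data.Empty using (⊥)
open import Relation.Nullary using (¬_; does)
open import Relation.Binary.PropositionalEquality using (_≡_; _≢_)
open import Function using (Injective; _⇔_)

record Digraph (n : ℕ) : Set where
  field
    arc     : Fin n → Fin n → Bool
    noLoops : ∀ v → arc v v ≡ false
open Digraph public

Arc : ∀ {n} → Digraph n → Fin n → Fin n → Set
Arc D u v = T (arc D u v)

countFin : ∀ n → (Fin n → Bool) → ℕ
countFin n p = sum (map (λ y → if p y then 1 else 0) (allFin n))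

outdeg : ∀ {n} → Digraph n → Fin n → ℕ
outdeg {n} D v = countFin n (arc D v)

-- D is an orientation of the complete k-partite graph with (nonempty)
-- partite sets part⁻¹(i), i : Fin k, and k ≥ 3.
record IsMultipartiteTournament {n : ℕ} (D : Digraph n) (k : ℕ) (part : Fin n → Fin k) : Set where
  field
    atLeast3  : 3 ≤ k
    nonempty  : ∀ (i : Fin k) → ∃[ v ] part v ≡ i
    noInside  : ∀ u v → part u ≡ part v → ¬ Arc D u v
    oneAcross : ∀ u v → part u ≢ part v → (Arc D u v × ¬ Arc D v u) ⊎ (Arc D v u × ¬ Arc D u v)

partSize : ∀ {n k} → (Fin n → Fin k) → Fin k → ℕ
partSize {n} part i = countFin n (λ v → does (part v ≟ i))

-- d_{D-z}(a,b) ≤ 1   (for a, b ≠ z)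
Within1 : ∀ {n} → Digraph n → Fin n → Fin n → Fin n → Set
Within1 D z a b = a ≡ b ⊎ Arc D a b

-- d_{D-z}(a,b) ≤ 2   (for a, b ≠ z): intermediate vertex must avoid z
Within2 : ∀ {n} → Digraph n → Fin n → Fin n → Fin n → Set
Within2 D z a b = Within1 D z a b ⊎ (∃[ x ] (x ≢ z × Arc D a x × Arc D x b))

C12 : ∀ {n} → Digraph n → Fin n → Fin n → Set
C12 D u v = u ≢ v × ∃[ w ] (w ≢ u × w ≢ v ×
  ((Within1 D v u w × Within2 D u v w) ⊎ (Within1 D u v w × Within2 D v u w)))

Competing12 : ∀ {n} → Digraph n → (Fin n → Set) → Set
Competing12 D S = ∀ u v → S u → S v → u ≢ v → C12 D u v

Loose : ∀ {n k} → Digraph n → (Fin n → Fin k) → Set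
Loose {k = k} D part = ∃[ i ] ¬ Competing12 D (λ v → part v ≡ i)

Succ : ∀ {m} → Fin m → Fin m → Set
Succ {m} i j = (toℕ j ≡ suc (toℕ i)) ⊎ (suc (toℕ i) ≡ m × toℕ j ≡ 0)

CycAdj : ∀ {m} → Fin m → Fin m → Set
CycAdj i j = Succ i j ⊎ Succ j i

InducedCycle : ∀ {n} → (Fin n → Fin n → Set) → (m : ℕ) → Set
InducedCycle {n} G m = Σ (Fin m → Fin n) λ c → Injective _≡_ _≡_ c ×
  (∀ i j → i ≢ j → (G (c i) (c j) ⇔ CycAdj i j))

Chordal : ∀ {n} → (Fin n → Fin n → Set) → Set
Chordal G = ∀ m → 4 ≤ m → ¬ InducedCycle G m

-- A sink z is isolated in C₁,₂(D), and any two non-sinks u, v are adjacent there.  If u and v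
-- lie in different partite sets, both have an arc into z (or, when u shares z's partite set, v
-- has one and u reaches z in two steps avoiding v).  If they lie in the same partite set, take
-- two out-neighbours of each (no outdegree is one): either one of them is a common prey, or they
-- give alternating 4-cycles u → xᵢ → v → yⱼ → u, and the arc between xᵢ and yⱼ yields a prey
-- reached in one and two steps, unless x₁, x₂, y₁, y₂ all lie in one partite set, which has at
-- most three vertices.  The same-part case also shows that a partite set free of sinks is
-- {1,2}-competing, so looseness provides a sink.  Hence C₁,₂(D) is a clique plus isolated
-- vertices, which has no induced cycle of length at least four.
module Submission where

open import Defs
open import Data.Nat using (ℕ; zero; suc; _+_; _≤_; z≤n; s≤s) renaming (_≟_ to _ℕ≟_)
open import Data.Nat.Properties using (+-suc; ≤-trans)
open import Data.Nat.ListAction using (sum)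
open import Data.Fin using (Fin; zero; suc; _≟_)
open import Data.Fin.Properties using (any?)
open import Data.Bool using (Bool; true; false; if_then_else_; T; not; _∧_)
open import Data.List using (List; []; _∷_; length)
open import Data.List.Properties using (map-tabulate)
open import Data.List.Relation.Unary.All as All using (All; []; _∷_)
open import Data.List.Relation.Unary.AllPairs using ([]; _∷_)
open import Data.List.Relation.Unary.Unique.Propositional using (Unique)
open import Data.Product using (_×_; ∃-syntax; ∃₂; _,_)
open import Data.Sum using (_⊎_; inj₁; inj₂; swap)
open import Data.Empty using (⊥; ⊥-elim)
open import Relation.Nullary using (¬_; does; yes; no)
open import Relation.Binary.PropositionalEquality
  using (_≡_; _≢_; refl; sym; trans; cong; subst; module ≡-Reasoning)
open import Function using (_∘_; _$_; case_of_; Equivalence)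

countFin-suc : ∀ n (p : Fin (suc n) → Bool) →
  countFin (suc n) p ≡ (if p zero then 1 else 0) + countFin n (p ∘ suc)
countFin-suc n p = cong (λ xs → f zero + sum xs)
  (trans (map-tabulate suc f) (sym (map-tabulate (λ y → y) (f ∘ suc))))
  where f = λ y → if p y then 1 else 0

countFin-witness : ∀ n (p : Fin n → Bool) → countFin n p ≢ 0 → ∃[ y ] T (p y)
countFin-witness zero p c≢0 = ⊥-elim (c≢0 refl)
countFin-witness (suc n) p c≢0 with p zero in p0 | countFin-suc n p
... | true  | _  = zero , subst T (sym p0) _
... | false | c≡ with countFin-witness n (p ∘ suc) (c≢0 ∘ trans c≡)
...   | y , py = suc y , py

-- The test on z comes first so that without p zero ∘ suc and without p (suc y) ∘ suc reduce
-- definitionally to p ∘ suc and without (p ∘ suc) y.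
without : ∀ {n} → (Fin n → Bool) → Fin n → Fin n → Bool
without p y z = not (does (z ≟ y)) ∧ p z

T-without : ∀ {n} (p : Fin n → Bool) {y z} → z ≢ y → T (p z) → T (without p y z)
T-without p {y} {z} z≢y pz with z ≟ y
... | yes z≡y = ⊥-elim (z≢y z≡y)
... | no _    = pz

T-without⁻ : ∀ {n} (p : Fin n → Bool) {y z} → T (without p y z) → z ≢ y × T (p z)
T-without⁻ p {y} {z} t with z ≟ y
... | no z≢y = z≢y , t

countFin-without : ∀ n (p : Fin n → Bool) y → T (p y) →
  countFin n p ≡ suc (countFin n (without p y))
countFin-without (suc n) p zero py with p zero | countFin-suc n p | countFin-suc n (without p zero)
... | true | c≡ | c′≡ = trans c≡ (cong suc (sym c′≡))
countFin-without (suc n) p (suc y) py = begin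
  countFin (suc n) p                                              ≡⟨ countFin-suc n p ⟩
  ind (p zero) + countFin n (p ∘ suc)                             ≡⟨ cong (ind (p zero) +_) (countFin-without n (p ∘ suc) y py) ⟩
  ind (p zero) + suc (countFin n (without (p ∘ suc) y))           ≡⟨ +-suc (ind (p zero)) _ ⟩
  suc (ind (p zero) + countFin n (without (p ∘ suc) y))           ≡⟨ cong suc (sym (countFin-suc n (without p (suc y)))) ⟩
  suc (countFin (suc n) (without p (suc y)))                      ∎
  where
  open ≡-Reasoning
  ind : Bool → ℕ
  ind b = if b then 1 else 0

length≤countFin : ∀ n (p : Fin n → Bool) (xs : List (Fin n)) →
  Unique xs → All (T ∘ p) xs → length xs ≤ countFin n p
length≤countFin n p []       _              _          = z≤n
length≤countFin n p (x ∷ xs) (x∉xs ∷ uniq) (px ∷ pxs) =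
  subst (suc (length xs) ≤_) (sym (countFin-without n p x px))
    (s≤s (length≤countFin n (without p x) xs uniq
      (All.zipWith (λ (x≢y , py) → T-without p (x≢y ∘ sym) py) (x∉xs , pxs))))

countFin-two-witnesses : ∀ n (p : Fin n → Bool) → countFin n p ≢ 0 → countFin n p ≢ 1 →
  ∃₂ λ a b → a ≢ b × T (p a) × T (p b)
countFin-two-witnesses n p c≢0 c≢1 with countFin-witness n p c≢0
... | a , pa with countFin-witness n (without p a) (c≢1 ∘ trans (countFin-without n p a pa) ∘ cong suc)
...   | b , pb′ with T-without⁻ p pb′
...     | b≢a , pb = a , b , b≢a ∘ sym , pa , pb

non-isolated-clique⇒chordal : ∀ {n} (G : Fin n → Fin n → Set) →
  (∀ {u v} → u ≢ v → ∃[ w ] G u w → ∃[ w ] G v w → G u v) → Chordal G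
non-isolated-clique⇒chordal G clique (suc (suc (suc (suc m)))) (s≤s (s≤s (s≤s (s≤s _)))) (c , c-inj , adj) =
  ¬adj₀₂ (Equivalence.to (adj c₀ c₂ λ ()) (clique (λ e → case c-inj e of λ ()) (_ , edge₀₁) (_ , edge₂₃)))
  where
  c₀ c₁ c₂ c₃ : Fin (suc (suc (suc (suc m))))
  c₀ = zero
  c₁ = suc zero
  c₂ = suc (suc zero)
  c₃ = suc (suc (suc zero))
  edge₀₁ : G (c c₀) (c c₁)
  edge₀₁ = Equivalence.from (adj c₀ c₁ λ ()) (inj₁ (inj₁ refl))
  edge₂₃ : G (c c₂) (c c₃)
  edge₂₃ = Equivalence.from (adj c₂ c₃ λ ()) (inj₁ (inj₁ refl))
  ¬adj₀₂ : ¬ CycAdj c₀ c₂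
  ¬adj₀₂ (inj₁ (inj₁ ()))
  ¬adj₀₂ (inj₁ (inj₂ ()))
  ¬adj₀₂ (inj₂ (inj₁ ()))
  ¬adj₀₂ (inj₂ (inj₂ ()))

Sink : ∀ {n} → Digraph n → Fin n → Set
Sink D v = outdeg D v ≡ 0

module _ {n} (D : Digraph n) where

  arc-irrefl : ∀ {u v} → Arc D u v → u ≢ v
  arc-irrefl {u} a refl = subst T (noLoops D u) a

  sink-¬arc : ∀ {z y} → Sink D z → ¬ Arc D z y
  sink-¬arc {z} {y} sink a =
    case subst (1 ≤_) sink (length≤countFin n (arc D z) (y ∷ []) ([] ∷ []) (a ∷ [])) of λ ()

  sink-isolated : ∀ {z u} → Sink D z → ¬ C12 D z u
  sink-isolated sink (_ , w , w≢z , _ , option) with option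
  ... | inj₁ (inj₁ z≡w , _)                = w≢z (sym z≡w)
  ... | inj₁ (inj₂ zw , _)                 = sink-¬arc sink zw
  ... | inj₂ (_ , inj₁ (inj₁ z≡w))         = w≢z (sym z≡w)
  ... | inj₂ (_ , inj₁ (inj₂ zw))          = sink-¬arc sink zw
  ... | inj₂ (_ , inj₂ (_ , _ , zx , _))   = sink-¬arc sink zx

  C12-sym : ∀ {u v} → C12 D u v → C12 D v u
  C12-sym (u≢v , w , w≢u , w≢v , option) =
    u≢v ∘ sym , w , w≢v , w≢u , swap option

  C12-common-out-neighbour : ∀ {u v w} → u ≢ v → Arc D u w → Arc D v w → C12 D u v
  C12-common-out-neighbour u≢v uw vw =
    u≢v , _ , arc-irrefl uw ∘ sym , arc-irrefl vw ∘ sym , inj₁ (inj₂ uw , inj₁ (inj₂ vw))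

module _ {n k} {D : Digraph n} {part : Fin n → Fin k} (MT : IsMultipartiteTournament D k part) where
  open IsMultipartiteTournament MT

  arc-crosses : ∀ {u v} → Arc D u v → part u ≢ part v
  arc-crosses uv same = noInside _ _ same uv

  arc-asym : ∀ {u v} → Arc D u v → ¬ Arc D v u
  arc-asym uv vu with oneAcross _ _ (arc-crosses uv)
  ... | inj₁ (_ , ¬vu) = ¬vu vu
  ... | inj₂ (_ , ¬uv) = ¬uv uv

  arc-into-sink : ∀ {u z} → Sink D z → part u ≢ part z → Arc D u z
  arc-into-sink sink u≁z with oneAcross _ _ u≁z
  ... | inj₁ (uz , _) = uz
  ... | inj₂ (zu , _) = ⊥-elim (sink-¬arc D sink zu)

  C12-or-arc-into : ∀ {u v x} → u ≢ v → part u ≡ part v → Arc D u x → C12 D u v ⊎ Arc D x v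
  C12-or-arc-into u≢v same ux with oneAcross _ _ (arc-crosses ux ∘ trans same ∘ sym)
  ... | inj₁ (xv , _) = inj₂ xv
  ... | inj₂ (vx , _) = inj₁ (C12-common-out-neighbour D u≢v ux vx)

  C12-of-alternating-4-cycle : ∀ {u v x y} → u ≢ v →
    Arc D u x → Arc D x v → Arc D v y → Arc D y u → part x ≢ part y → C12 D u v
  C12-of-alternating-4-cycle u≢v ux xv vy yu x≁y with oneAcross _ _ x≁y
  ... | inj₁ (xy , _) = u≢v , _ , arc-irrefl D yu , arc-irrefl D vy ∘ sym ,
                        inj₂ (inj₂ vy , inj₂ (_ , arc-irrefl D xv , ux , xy))
  ... | inj₂ (yx , _) = u≢v , _ , arc-irrefl D ux ∘ sym , arc-irrefl D xv ,
                        inj₁ (inj₂ ux , inj₂ (_ , arc-irrefl D yu , vy , yx))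

  module _ (small : ∀ i → partSize part i ≤ 3) where

    ¬four-in-a-part : ∀ {i a b c d} → a ≢ b → a ≢ c → a ≢ d → b ≢ c → b ≢ d → c ≢ d →
      part a ≡ i → part b ≡ i → part c ≡ i → part d ≡ i → ⊥
    ¬four-in-a-part {i} a≢b a≢c a≢d b≢c b≢d c≢d a∈i b∈i c∈i d∈i =
      case ≤-trans (length≤countFin n _ (_ ∷ _ ∷ _ ∷ _ ∷ []) distinct members) (small _) of λ
        { (s≤s (s≤s (s≤s ()))) }
      where
      distinct = (a≢b ∷ a≢c ∷ a≢d ∷ []) ∷ (b≢c ∷ b≢d ∷ []) ∷ (c≢d ∷ []) ∷ [] ∷ []
      in-part : ∀ {v} → part v ≡ i → T (does (part v ≟ i))
      in-part {v} v∈i with part v ≟ i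
      ... | yes _    = _
      ... | no v∉i = v∉i v∈i
      members = in-part a∈i ∷ in-part b∈i ∷ in-part c∈i ∷ in-part d∈i ∷ []

    C12-of-back-arcs : ∀ {u v x₁ x₂ y₁ y₂} → u ≢ v → x₁ ≢ x₂ → y₁ ≢ y₂ →
      Arc D u x₁ → Arc D u x₂ → Arc D x₁ v → Arc D x₂ v →
      Arc D v y₁ → Arc D v y₂ → Arc D y₁ u → Arc D y₂ u → C12 D u v
    C12-of-back-arcs {v = v} {x₁} {x₂} {y₁} {y₂} u≢v x₁≢x₂ y₁≢y₂ ux₁ ux₂ x₁v x₂v vy₁ vy₂ y₁u y₂u
      with part x₁ ≟ part y₁ | part x₁ ≟ part y₂ | part x₂ ≟ part y₁
    ... | no x₁≁y₁ | _ | _ = C12-of-alternating-4-cycle u≢v ux₁ x₁v vy₁ y₁u x₁≁y₁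
    ... | yes _ | no x₁≁y₂ | _ = C12-of-alternating-4-cycle u≢v ux₁ x₁v vy₂ y₂u x₁≁y₂
    ... | yes _ | yes _ | no x₂≁y₁ = C12-of-alternating-4-cycle u≢v ux₂ x₂v vy₁ y₁u x₂≁y₁
    ... | yes x₁∼y₁ | yes x₁∼y₂ | yes x₂∼y₁ =
      ⊥-elim $ ¬four-in-a-part x₁≢x₂ (≢-through-v x₁v vy₁) (≢-through-v x₁v vy₂)
        (≢-through-v x₂v vy₁) (≢-through-v x₂v vy₂) y₁≢y₂
        x₁∼y₁ x₂∼y₁ refl (trans (sym x₁∼y₂) x₁∼y₁)
      where
      ≢-through-v : ∀ {x y} → Arc D x v → Arc D v y → x ≢ y
      ≢-through-v xv vy refl = arc-asym xv vy

  module _ (outdeg≢1 : ∀ v → outdeg D v ≢ 1) where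

    two-out-neighbours : ∀ {u} → ¬ Sink D u → ∃₂ λ a b → a ≢ b × Arc D u a × Arc D u b
    two-out-neighbours {u} ¬sink = countFin-two-witnesses n (arc D u) ¬sink (outdeg≢1 u)

    out-neighbour-avoiding : ∀ {u} t → ¬ Sink D u → ∃[ x ] x ≢ t × Arc D u x
    out-neighbour-avoiding t ¬sink with two-out-neighbours ¬sink
    ... | a , b , a≢b , ua , ub with a ≟ t
    ...   | no a≢t  = a , a≢t , ua
    ...   | yes refl = b , a≢b ∘ sym , ub

    C12-via-sink : ∀ {u v z} → Sink D z → u ≢ v → part u ≡ part z → part v ≢ part z →
      ¬ Sink D u → C12 D u v
    C12-via-sink {v = v} {z} sink u≢v u∼z v≁z ¬sink with out-neighbour-avoiding v ¬sink
    ... | x , x≢v , ux =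
      u≢v , z , (λ { refl → ¬sink sink }) , v≁z ∘ cong part ∘ sym ,
      inj₂ (inj₂ (arc-into-sink sink v≁z) ,
            inj₂ (x , x≢v , ux , arc-into-sink sink (arc-crosses ux ∘ trans u∼z ∘ sym)))

    module _ (small : ∀ i → partSize part i ≤ 3) where

      C12-in-same-part : ∀ {u v} → u ≢ v → part u ≡ part v → ¬ Sink D u → ¬ Sink D v → C12 D u v
      C12-in-same-part u≢v same ¬sinkᵤ ¬sinkᵥ
        with two-out-neighbours ¬sinkᵤ | two-out-neighbours ¬sinkᵥ
      ... | x₁ , x₂ , x₁≢x₂ , ux₁ , ux₂ | y₁ , y₂ , y₁≢y₂ , vy₁ , vy₂
        with C12-or-arc-into u≢v same ux₁ | C12-or-arc-into u≢v same ux₂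
           | C12-or-arc-into (u≢v ∘ sym) (sym same) vy₁ | C12-or-arc-into (u≢v ∘ sym) (sym same) vy₂
      ... | inj₁ c | _ | _ | _ = c
      ... | _ | inj₁ c | _ | _ = c
      ... | _ | _ | inj₁ c | _ = C12-sym D c
      ... | _ | _ | _ | inj₁ c = C12-sym D c
      ... | inj₂ x₁v | inj₂ x₂v | inj₂ y₁u | inj₂ y₂u =
        C12-of-back-arcs small u≢v x₁≢x₂ y₁≢y₂ ux₁ ux₂ x₁v x₂v vy₁ vy₂ y₁u y₂u

      C12-of-non-sinks : ∀ {z} → Sink D z → ∀ {u v} → u ≢ v → ¬ Sink D u → ¬ Sink D v → C12 D u v
      C12-of-non-sinks {z} sink {u} {v} u≢v ¬sinkᵤ ¬sinkᵥ
        with part u ≟ part v | part u ≟ part z | part v ≟ part z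
      ... | yes same | _ | _ = C12-in-same-part u≢v same ¬sinkᵤ ¬sinkᵥ
      ... | no u≁v | yes u∼z | yes v∼z = ⊥-elim (u≁v (trans u∼z (sym v∼z)))
      ... | no _ | yes u∼z | no v≁z = C12-via-sink sink u≢v u∼z v≁z ¬sinkᵤ
      ... | no _ | no u≁z | yes v∼z = C12-sym D (C12-via-sink sink (u≢v ∘ sym) v∼z u≁z ¬sinkᵥ)
      ... | no _ | no u≁z | no v≁z =
        C12-common-out-neighbour D u≢v (arc-into-sink sink u≁z) (arc-into-sink sink v≁z)

      loose⇒sink : Loose D part → ∃[ z ] Sink D z
      loose⇒sink (i , ¬competing) with any? (λ z → outdeg D z ℕ≟ 0)
      ... | yes sink = sink
      ... | no ¬sink = ⊥-elim $ ¬competing λ u v u∈i v∈i u≢v →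
        C12-in-same-part u≢v (trans u∈i (sym v∈i)) (¬sink ∘ (u ,_)) (¬sink ∘ (v ,_))

corollary4p7 : ∀ {n k} (D : Digraph n) (part : Fin n → Fin k) →
    IsMultipartiteTournament D k part →
    Loose D part →
    (∀ v → outdeg D v ≢ 1) →
    (∀ i → partSize part i ≤ 3) →
    Chordal (C12 D)
corollary4p7 D part MT loose outdeg≢1 small with loose⇒sink MT outdeg≢1 small loose
... | z , sink = non-isolated-clique⇒chordal (C12 D) λ u≢v (_ , uw) (_ , vw) →
  C12-of-non-sinks MT outdeg≢1 small sink u≢v
    (λ sinkᵤ → sink-isolated D sinkᵤ uw) (λ sinkᵥ → sink-isolated D sinkᵥ vw)
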